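{- Let $G$ be a graph. If $(d(G),d_t(G))\neq(2,1)$ (i.e. either $d(G)\neq 2$, or $G$ has no isolated vertices and $d_t(G)\neq 1$), then $d^{r}(G)=d(G)$.
   Context: All graphs are finite, simple and undirected. For $G=(V,E)$, a dominating set is $S\subseteq V$ with every vertex of $V-S$ adjacent to a vertex of $S$; a restrained dominating set is a dominating set $S$ such that every vertex of $V-S$ is adjacent to a vertex of $V-S$; for $G$ without isolated vertices, a total dominating set is $S$ such that every vertex of $V$ is adjacent to a vertex of $S$. The domatic number $d(G)$, restrained domatic number $d^{r}(G)$ and total domatic number $d_t(G)$ are the maximum numbers of classes of a partition of $V$ all of whose classes are dominating, restrained dominating, and total dominating sets, respectively. -}

module Defs where

open import Data.Nat using (ℕ)
open import Data.Fin using (Fin)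
open import Data.Bool using (Bool; T)
open import Data.Product using (Σ; _×_; ∃; ∃-syntax)
open import Relation.Nullary using (¬_)
open import Relation.Binary.PropositionalEquality using (_≡_)

record Graph : Set where
  field
    n     : ℕ
    E     : Fin n → Fin n → Bool
    sym   : ∀ u v → E u v ≡ E v u
    loopless : ∀ v → E v v ≡ Data.Bool.false

open Graph public

Adj : (G : Graph) → Fin (n G) → Fin (n G) → Set
Adj G u v = T (E G u v)

VSet : Graph → Set₁
VSet G = Fin (n G) → Set

NoIsolated : Graph → Set
NoIsolated G = ∀ v → ∃[ u ] Adj G v u

Dominating : (G : Graph) → VSet G → Set
Dominating G S = ∀ v → ¬ S v → ∃[ u ] (S u × Adj G v u)

RestrainedDominating : (G : Graph) → VSet G → Set
RestrainedDominating G S =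
  Dominating G S × (∀ v → ¬ S v → ∃[ u ] (¬ S u × Adj G v u))

TotalDominating : (G : Graph) → VSet G → Set
TotalDominating G S = ∀ v → ∃[ u ] (S u × Adj G v u)

-- A partition of V into k (nonempty) classes: a surjective labelling
-- f : V → Fin k; class i is {v | f v ≡ i}.
record Partition (G : Graph) (k : ℕ) : Set where
  field
    label : Fin (n G) → Fin k
    onto  : ∀ (i : Fin k) → ∃[ v ] (label v ≡ i)

open Partition public

Class : {G : Graph} {k : ℕ} → Partition G k → Fin k → VSet G
Class P i v = label P v ≡ i

AllClasses : (G : Graph) → (VSet G → Set) → ℕ → Set
AllClasses G Q k = Σ (Partition G k) (λ P → ∀ i → Q (Class P i))

IsMaxClasses : (G : Graph) → (VSet G → Set) → ℕ → Set
IsMaxClasses G Q m = AllClasses G Q m × (∀ k → AllClasses G Q k → k Data.Nat.≤ m)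

IsDomaticNumber : Graph → ℕ → Set
IsDomaticNumber G = IsMaxClasses G (Dominating G)

IsRestrainedDomaticNumber : Graph → ℕ → Set
IsRestrainedDomaticNumber G = IsMaxClasses G (RestrainedDominating G)

-- d_t(G) = m  (only meaningful for G without isolated vertices)
IsTotalDomaticNumber : Graph → ℕ → Set
IsTotalDomaticNumber G = IsMaxClasses G (TotalDominating G)

-- A domatic partition with at least three classes is already restrained: a vertex
-- outside class i is dominated by a class different from both i and its own class. A partition {S, V − S} into two classes
-- is restrained exactly when S and V − S are both total dominating; such a pair
-- exists (decidably, by searching all subsets) unless the total domatic number is 1.
-- Conversely every restrained domatic partition is domatic, so d^r(G) ≤ d(G).
module Submission where

open import Defs
open import Data.Nat using (ℕ; zero; suc; _+_; z≤n; s≤s; _≤_)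
open import Data.Fin using (Fin; zero; suc; _≟_)
open import Data.Fin.Subset using (Subset; _∈_; _∉_)
open import Data.Fin.Subset.Properties using (_∈?_; anySubset?)
open import Data.Bool using (true; false; if_then_else_)
open import Data.Bool.Properties using (not-¬)
open import Data.Vec using (lookup; tabulate)
open import Data.Vec.Properties using (lookup∘tabulate; lookup⇒[]=; []=⇒lookup)
open import Data.Fin.Properties using (all?; any?; 0≢1+n)
open import Data.Sum using (_⊎_; inj₁; inj₂)
open import Data.Product using (_×_; _,_; proj₁; ∃; map₂)
open import Function using (_∘_; _$_)
open import Relation.Binary.PropositionalEquality as ≡ using (_≡_; _≢_; refl; trans; cong)
open import Relation.Nullary using (¬_; Dec; yes; no; does; contradiction; ¬?)
open import Relation.Nullary.Decidable using (T?; _×-dec_; dec-true; dec-false)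
open import Relation.Unary using (Decidable)

module _ (G : Graph) where

  totalDominating-mono : {S S′ : VSet G} → (∀ v → S v → S′ v) →
    TotalDominating G S → TotalDominating G S′
  totalDominating-mono S⊆S′ td v =
    let (u , u∈S , v~u) = td v in u , S⊆S′ u u∈S , v~u

  totalDominating? : {S : VSet G} → Decidable S → Dec (TotalDominating G S)
  totalDominating? S? = all? λ v → any? λ u → S? u ×-dec T? (E G v u)

  total-disjoint⇒restrained : {S T : VSet G} →
    TotalDominating G S → TotalDominating G T → (∀ v → T v → ¬ S v) →
    RestrainedDominating G S
  total-disjoint⇒restrained tdS tdT T∩S=∅ =
      (λ v _ → tdS v)
    , (λ v _ → let (u , u∈T , v~u) = tdT v in u , T∩S=∅ u u∈T , v~u)

  TotalDomaticBipartition : Subset (n G) → Set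
  TotalDomaticBipartition p = TotalDominating G (_∈ p) × TotalDominating G (_∉ p)

  totalDomaticBipartition? : Decidable TotalDomaticBipartition
  totalDomaticBipartition? p =
    totalDominating? (_∈? p) ×-dec totalDominating? (λ v → ¬? (v ∈? p))

module _ {G : Graph} {k : ℕ} (P : Partition G k) where

  class-disjoint : ∀ {i j} → i ≢ j → ∀ v → Class P j v → ¬ Class P i v
  class-disjoint i≢j v v∈j v∈i = i≢j (trans (≡.sym v∈i) v∈j)

restrained⇒domatic : ∀ {G k} →
  AllClasses G (RestrainedDominating G) k → AllClasses G (Dominating G) k
restrained⇒domatic = map₂ (proj₁ ∘_)

fin1-unique : (i j : Fin 1) → i ≡ j
fin1-unique zero zero = refl

domatic⇒restrained₁ : ∀ {G} →
  AllClasses G (Dominating G) 1 → AllClasses G (RestrainedDominating G) 1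
domatic⇒restrained₁ (P , dom) =
  P , λ i → dom i , λ v v∉i → contradiction (fin1-unique (label P v) i) v∉i

avoid₂ : ∀ {k} (a b : Fin (3 + k)) → ∃ λ l → l ≢ a × l ≢ b
avoid₂ zero          zero          = suc zero , (λ ()) , (λ ())
avoid₂ zero          (suc zero)    = suc (suc zero) , (λ ()) , (λ ())
avoid₂ zero          (suc (suc _)) = suc zero , (λ ()) , (λ ())
avoid₂ (suc zero)    zero          = suc (suc zero) , (λ ()) , (λ ())
avoid₂ (suc (suc _)) zero          = suc zero , (λ ()) , (λ ())
avoid₂ (suc _)       (suc _)       = zero , (λ ()) , (λ ())

domatic⇒restrained₃₊ : ∀ {G k} →
  AllClasses G (Dominating G) (3 + k) → AllClasses G (RestrainedDominating G) (3 + k)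
domatic⇒restrained₃₊ {G} (P , dom) = P , λ i → dom i , restrained i
  where
  restrained : ∀ i v → ¬ Class P i v → ∃ λ u → ¬ Class P i u × Adj G v u
  restrained i v _ with avoid₂ i (label P v)
  ... | l , l≢i , l≢own =
    let (u , u∈l , v~u) = dom l v (l≢own ∘ ≡.sym) in
    u , class-disjoint P (l≢i ∘ ≡.sym) u u∈l , v~u

toSubset : ∀ {n} {P : Fin n → Set} → Decidable P → Subset n
toSubset P? = tabulate (does ∘ P?)

module _ {n} {P : Fin n → Set} (P? : Decidable P) where

  ∈-toSubset : ∀ {v} → P v → v ∈ toSubset P?
  ∈-toSubset {v} pv = lookup⇒[]= v _ (trans (lookup∘tabulate _ v) (dec-true (P? v) pv))

  ∉-toSubset : ∀ {v} → ¬ P v → v ∉ toSubset P?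
  ∉-toSubset {v} ¬pv v∈ = not-¬ refl $ begin
    true                    ≡⟨ ≡.sym ([]=⇒lookup v∈) ⟩
    lookup (toSubset P?) v  ≡⟨ lookup∘tabulate _ v ⟩
    does (P? v)             ≡⟨ dec-false (P? v) ¬pv ⟩
    false                   ∎
    where open ≡.≡-Reasoning

totalClasses⇒restrained₂ : ∀ {G} (P : Partition G 2) →
  TotalDominating G (Class P zero) → TotalDominating G (Class P (suc zero)) →
  ∀ i → RestrainedDominating G (Class P i)
totalClasses⇒restrained₂ {G} P td₀ td₁ zero =
  total-disjoint⇒restrained G td₀ td₁ (class-disjoint P λ ())
totalClasses⇒restrained₂ {G} P td₀ td₁ (suc zero) =
  total-disjoint⇒restrained G td₁ td₀ (class-disjoint P λ ())

bipartition⇒restrained₂ : ∀ {G} (p : Subset (n G)) → Fin (n G) →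
  TotalDomaticBipartition G p → AllClasses G (RestrainedDominating G) 2
bipartition⇒restrained₂ {G} p v₀ (tdIn , tdOut) =
  P , totalClasses⇒restrained₂ P (totalDominating-mono G in⇒zero tdIn)
                                  (totalDominating-mono G out⇒one tdOut)
  where
  side : Fin (n G) → Fin 2
  side v = if does (v ∈? p) then zero else suc zero

  in⇒zero : ∀ v → v ∈ p → side v ≡ zero
  in⇒zero v v∈p = cong (if_then zero else suc zero) (dec-true (v ∈? p) v∈p)

  out⇒one : ∀ v → v ∉ p → side v ≡ suc zero
  out⇒one v v∉p = cong (if_then zero else suc zero) (dec-false (v ∈? p) v∉p)

  P : Partition G 2
  P = record { label = side ; onto = λ where
    zero       → let (u , u∈p , _) = tdIn v₀  in u , in⇒zero u u∈p
    (suc zero) → let (u , u∉p , _) = tdOut v₀ in u , out⇒one u u∉p }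

totalDomatic⇒bipartition : ∀ {G k} →
  AllClasses G (TotalDominating G) (2 + k) → ∃ (TotalDomaticBipartition G)
totalDomatic⇒bipartition {G} (Q , td) =
  p , totalDominating-mono G first⊆p (td zero) , totalDominating-mono G second⊆∁p (td (suc zero))
  where
  inFirst? : Decidable (λ v → label Q v ≡ zero)
  inFirst? v = label Q v ≟ zero

  p : Subset (n G)
  p = toSubset inFirst?

  first⊆p : ∀ v → Class Q zero v → v ∈ p
  first⊆p _ = ∈-toSubset inFirst?

  second⊆∁p : ∀ v → Class Q (suc zero) v → v ∉ p
  second⊆∁p v v∈second = ∉-toSubset inFirst? (class-disjoint Q 0≢1+n v v∈second)

totalDomatic≡1 : ∀ {G} → NoIsolated G → Fin (n G) →
  ¬ ∃ (TotalDomaticBipartition G) → IsTotalDomaticNumber G 1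
totalDomatic≡1 {G} noIsolated v₀ noBipartition = (P , λ { zero → noIsolated′ }) , atMostOne
  where
  P : Partition G 1
  P = record { label = λ _ → zero ; onto = λ { zero → v₀ , refl } }

  noIsolated′ : TotalDominating G (Class P zero)
  noIsolated′ v = let (u , v~u) = noIsolated v in u , refl , v~u

  atMostOne : ∀ k → AllClasses G (TotalDominating G) k → k ≤ 1
  atMostOne zero          _ = z≤n
  atMostOne (suc zero)    _ = s≤s z≤n
  atMostOne (suc (suc k)) Q = contradiction (totalDomatic⇒bipartition Q) noBipartition

restrainedDomatic₂ : ∀ {G} → NoIsolated G → (∀ t → IsTotalDomaticNumber G t → t ≢ 1) →
  Fin (n G) → AllClasses G (RestrainedDominating G) 2
restrainedDomatic₂ {G} noIsolated d_t≢1 v₀ with anySubset? (totalDomaticBipartition? G)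
... | yes (p , bipartition) = bipartition⇒restrained₂ p v₀ bipartition
... | no noBipartition = contradiction refl (d_t≢1 1 (totalDomatic≡1 noIsolated v₀ noBipartition))

corollary4p6 : (G : Graph) (m : ℕ) → IsDomaticNumber G m →
    (m ≢ 2 ⊎ (NoIsolated G × (∀ t → IsTotalDomaticNumber G t → t ≢ 1))) →
    IsRestrainedDomaticNumber G m
corollary4p6 G m (domatic , maximal) hyp =
  restrained m domatic hyp , λ k → maximal k ∘ restrained⇒domatic
  where
  restrained : ∀ m → AllClasses G (Dominating G) m →
    (m ≢ 2 ⊎ (NoIsolated G × (∀ t → IsTotalDomaticNumber G t → t ≢ 1))) →
    AllClasses G (RestrainedDominating G) m
  restrained zero          (P , _) _ = P , λ ()
  restrained 1             D       _ = domatic⇒restrained₁ D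
  restrained 2             _       (inj₁ m≢2) = contradiction refl m≢2
  restrained 2             (P , _) (inj₂ (noIsolated , d_t≢1)) =
    restrainedDomatic₂ noIsolated d_t≢1 (proj₁ (onto P zero))
  restrained (suc (suc (suc k))) D _ = domatic⇒restrained₃₊ D
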